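{- For $m\ge 3$, let $\psi_m$ be the Horn CNF consisting of the clauses $\neg x_i\vee\neg y_i\vee z_i$ for $i=1,\dots,m-1$; $\neg x_m\vee\neg z_1\vee\dots\vee\neg z_{m-1}$; $\neg x_i\vee x_{i+1}$ for $i=1,\dots,m-1$; and $\neg x_m\vee x_1$. There is a PC encoding of the function represented by $\psi_m$ of size linear in the number of variables.
   Context: Size is the number of clauses. A partial assignment is a set of literals with no complementary pair, identified with their conjunction; $\vdash_1$ denotes derivability by repeated unit resolution (deriving $C\setminus\{l\}$ from $C\ni l$ and $\neg l$); $\bot$ is the empty clause. A CNF $\varphi(\mathbf{z})$ is PC if for every partial assignment $\alpha$ of $\mathbf{z}$ and literal $l$ on $\mathbf{z}$ with $\varphi\wedge\alpha\models l$, $\varphi\wedge\alpha\vdash_1 l$ or $\varphi\wedge\alpha\vdash_1\bot$. A CNF $\psi(\mathbf{x},\mathbf{y})$ is an encoding of $f(\mathbf{x})$ if $f(\mathbf{a})=\exists\mathbf{b}\,\psi(\mathbf{a},\mathbf{b})$ for all $\mathbf{a}$; a PC encoding is an encoding that is PC on all its variables. -}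

module Defs where

open import Data.Bool using (Bool; true; false; not; _∧_; _∨_)
open import Data.Nat using (ℕ; zero; suc; _∸_)
open import Data.Fin using (Fin; zero; suc; inject₁; fromℕ)
open import Data.Fin.Properties renaming (_≟_ to _≟F_)
open import Data.Sum using (_⊎_; inj₁; inj₂)
open import Data.Sum.Properties using (≡-dec)
open import Data.List using (List; []; _∷_; _++_; map; filter; concatMap; length)
open import Data.List.Membership.Propositional using (_∈_; _∉_)
open import Data.List.Relation.Unary.All using (All)
open import Data.Product using (Σ; _×_; _,_)
open import Relation.Nullary using (¬_; yes; no; ¬?)
open import Relation.Binary.Definitions using (DecidableEquality)
open import Relation.Binary.PropositionalEquality using (_≡_; refl; cong)

data Lit (V : Set) : Set where
  pos : V → Lit V
  neg : V → Lit V

Clause : Set → Set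
Clause V = List (Lit V)

CNF : Set → Set
CNF V = List (Clause V)

size : {V : Set} → CNF V → ℕ
size = length

comp : {V : Set} → Lit V → Lit V
comp (pos v) = neg v
comp (neg v) = pos v

litDec : {V : Set} → DecidableEquality V → DecidableEquality (Lit V)
litDec d (pos u) (pos v) with d u v
... | yes refl = yes refl
... | no u≢v = no λ { refl → u≢v refl }
litDec d (pos u) (neg v) = no λ ()
litDec d (neg u) (pos v) = no λ ()
litDec d (neg u) (neg v) with d u v
... | yes refl = yes refl
... | no u≢v = no λ { refl → u≢v refl }

evalLit : {V : Set} → (V → Bool) → Lit V → Bool
evalLit σ (pos v) = σ v
evalLit σ (neg v) = not (σ v)

evalClause : {V : Set} → (V → Bool) → Clause V → Bool
evalClause σ [] = false
evalClause σ (l ∷ C) = evalLit σ l ∨ evalClause σ C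

evalCNF : {V : Set} → (V → Bool) → CNF V → Bool
evalCNF σ [] = true
evalCNF σ (C ∷ φ) = evalClause σ C ∧ evalCNF σ φ

-- Partial assignments: sets (lists) of literals with no complementary pair,
-- identified with the conjunction of their literals.

IsPartialAssignment : {V : Set} → List (Lit V) → Set
IsPartialAssignment α = ∀ l → l ∈ α → comp l ∉ α

_∧ᵤ_ : {V : Set} → CNF V → List (Lit V) → CNF V
φ ∧ᵤ α = φ ++ map (λ l → l ∷ []) α

Entails : {V : Set} → CNF V → List (Lit V) → Lit V → Set
Entails φ α l = ∀ σ → evalCNF σ φ ≡ true → All (λ l′ → evalLit σ l′ ≡ true) α →
                evalLit σ l ≡ true

module UnitResolution {V : Set} (_≟_ : DecidableEquality (Lit V)) where

  remove : Lit V → Clause V → Clause V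
  remove l C = filter (λ l′ → ¬? (l′ ≟ l)) C

  data Derives (Φ : CNF V) : Clause V → Set where
    axiom : ∀ {C} → C ∈ Φ → Derives Φ C
    unitRes : ∀ {C l} → Derives Φ C → l ∈ C → Derives Φ (comp l ∷ []) →
              Derives Φ (remove l C)

  -- Φ ⊢₁ l : the unit clause l is derived (clauses are read as sets)
  DerivesLit : CNF V → Lit V → Set
  DerivesLit Φ l = Σ (Clause V) λ C → Derives Φ C × l ∈ C × All (_≡ l) C

  DerivesEmpty : CNF V → Set
  DerivesEmpty Φ = Derives Φ []

open UnitResolution public

IsPC : {V : Set} → DecidableEquality V → CNF V → Set
IsPC {V} d φ = ∀ (α : List (Lit V)) (l : Lit V) → IsPartialAssignment α →
  Entails φ α l →
  DerivesLit (litDec d) (φ ∧ᵤ α) l ⊎ DerivesEmpty (litDec d) (φ ∧ᵤ α)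

join : {X : Set} {k : ℕ} → (X → Bool) → (Fin k → Bool) → (X ⊎ Fin k → Bool)
join a b (inj₁ x) = a x
join a b (inj₂ j) = b j

IsEncoding : {X : Set} {k : ℕ} → ((X → Bool) → Bool) → CNF (X ⊎ Fin k) → Set
IsEncoding {X} {k} f ψ = ∀ (a : X → Bool) →
  (f a ≡ true → Σ (Fin k → Bool) λ b → evalCNF (join a b) ψ ≡ true) ×
  (Σ (Fin k → Bool) (λ b → evalCNF (join a b) ψ ≡ true) → f a ≡ true)

IsPCEncoding : {X : Set} {k : ℕ} → DecidableEquality X →
               ((X → Bool) → Bool) → CNF (X ⊎ Fin k) → Set
IsPCEncoding d f ψ = IsEncoding f ψ × IsPC (≡-dec d _≟F_) ψ

-- The Horn CNF ψ_m, indexed by n = m - 1.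
-- Variables x_1..x_m  (x i, i : Fin (suc n), x zero = x_1, x (fromℕ n) = x_m),
--           y_1..y_{m-1}, z_1..z_{m-1}  (y i, z i, i : Fin n).

data PsiVar (n : ℕ) : Set where
  x : Fin (suc n) → PsiVar n
  y : Fin n → PsiVar n
  z : Fin n → PsiVar n

psiVarDec : {n : ℕ} → DecidableEquality (PsiVar n)
psiVarDec (x i) (x j) with i ≟F j
... | yes refl = yes refl
... | no p = no λ { refl → p refl }
psiVarDec (x i) (y j) = no λ ()
psiVarDec (x i) (z j) = no λ ()
psiVarDec (y i) (x j) = no λ ()
psiVarDec (y i) (y j) with i ≟F j
... | yes refl = yes refl
... | no p = no λ { refl → p refl }
psiVarDec (y i) (z j) = no λ ()
psiVarDec (z i) (x j) = no λ ()
psiVarDec (z i) (y j) = no λ ()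
psiVarDec (z i) (z j) with i ≟F j
... | yes refl = yes refl
... | no p = no λ { refl → p refl }

allFin′ : (n : ℕ) → List (Fin n)
allFin′ zero = []
allFin′ (suc n) = zero ∷ map suc (allFin′ n)

psi : (n : ℕ) → CNF (PsiVar n)
psi n =
  map (λ i → neg (x (inject₁ i)) ∷ neg (y i) ∷ pos (z i) ∷ []) (allFin′ n)
  ++ (neg (x (fromℕ n)) ∷ map (λ i → neg (z i)) (allFin′ n)) ∷ []
  ++ map (λ i → neg (x (inject₁ i)) ∷ pos (x (suc i)) ∷ []) (allFin′ n)
  ++ (neg (x (fromℕ n)) ∷ pos (x zero) ∷ []) ∷ []

ψ : (m : ℕ) → CNF (PsiVar (m ∸ 1))
ψ m = psi (m ∸ 1)

fψ : (m : ℕ) → (PsiVar (m ∸ 1) → Bool) → Bool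
fψ m a = evalCNF a (ψ m)

numVars : ℕ → ℕ
numVars m = m Data.Nat.+ 2 Data.Nat.* (m ∸ 1)

module Submission where

-- The encoding adds a variable e equivalent to every xᵢ and variables aᵢ implied by yᵢ and
-- by zᵢ, with the clauses ¬e ∨ ¬aᵢ ∨ zᵢ and ¬e ∨ ¬a₁ ∨ … ∨ ¬a_{m-1}: 5m − 2 clauses in all.
-- The cycle ¬xᵢ ∨ xᵢ₊₁ forces the xᵢ to be equal, which is why e can stand for all of them,
-- and with e true aᵢ is equivalent to zᵢ, so that eliminating e and the aᵢ gives back ψ_m.
--
-- For propagation completeness let α ⊨ l with l ∉ α, so that ¬l ∧ α has no model. A partial
-- assignment β either contains one of four refutation patterns (literals propagating to e
-- and to ¬e; to e, aᵢ and ¬zᵢ; to e and to every aᵢ; to aᵢ together with ¬aᵢ), or it has an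
-- explicit model: with e true and aᵢ, zᵢ true exactly when some literal of β propagates to
-- aᵢ, or with e and all xᵢ false. So ¬l ∧ α contains a pattern; unit propagation from α
-- refutes it if it lies in α, and otherwise runs the pattern's clauses backwards from its
-- remaining literals to derive l.

open import Defs
open import Data.Bool using (Bool; true; false; not; _∨_)
open import Data.Bool.Properties using (∨-identityʳ; ∨-zeroʳ)
open import Data.Empty using (⊥; ⊥-elim)
open import Data.Fin using (Fin; zero; suc; inject₁; fromℕ)
open import Data.Fin.Induction using (<-weakInduction; >-weakInduction)
open import Data.Fin.Properties using (any?; all?; ¬∀⟶∃¬) renaming (_≟_ to _≟F_)
open import Data.List using (List; []; _∷_; _++_; map; length; tabulate)
open import Data.List.Properties using (map-∘; length-++; length-tabulate; filter-notAll)
open import Data.List.Membership.Propositional using (_∈_; _∉_; find; lose)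
open import Data.List.Membership.Propositional.Properties
  using (∈-++⁺ˡ; ∈-++⁺ʳ; ∈-map⁺; ∈-tabulate⁺; ∈-filter⁺; ∈-filter⁻)
open import Data.List.Relation.Unary.All as All using (All; []; _∷_)
open import Data.List.Relation.Unary.All.Properties.Core using (¬All⇒Any¬)
import Data.List.Relation.Unary.All.Properties as AllP
open import Data.List.Relation.Unary.Any as Any using (Any; here; there)
import Data.List.Relation.Unary.Any.Properties as AnyP
open import Data.List.Relation.Unary.AllPairs using ([]; _∷_)
open import Data.List.Relation.Unary.Unique.Propositional using (Unique)
import Data.List.Relation.Unary.Unique.Propositional.Properties as UniqueP
open import Data.Nat using (ℕ; zero; suc; _+_; _*_; _∸_; _≤_; _<_)
open import Data.Nat.Properties
  using (≤-refl; ≤-trans; ≤-pred; m≤m+n; *-monoʳ-≤; module ≤-Reasoning)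
open import Data.Nat.Tactic.RingSolver using (solve-∀)
open import Data.Product using (Σ; ∃; _×_; _,_; proj₁)
open import Data.Sum as Sum using (_⊎_; inj₁; inj₂; [_,_]′)
open import Data.Sum.Properties using (≡-dec)
open import Relation.Binary.Definitions using (DecidableEquality)
open import Relation.Binary.PropositionalEquality
  using (_≡_; _≢_; refl; sym; trans; cong; cong₂; subst; module ≡-Reasoning)
open import Relation.Nullary using (¬_; Dec; yes; no; does; ¬?)
open import Relation.Nullary.Decidable using (_×-dec_; dec-true; dec-false)
open import Level using (0ℓ)
open import Function using (id)
open import Relation.Unary using (Pred; Decidable)

comp-involutive : ∀ {V : Set} (l : Lit V) → comp (comp l) ≡ l
comp-involutive (pos _) = refl
comp-involutive (neg _) = refl

comp-injective : ∀ {V : Set} {l l′ : Lit V} → comp l ≡ comp l′ → l ≡ l′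
comp-injective {l = pos _} {pos _} refl = refl
comp-injective {l = neg _} {neg _} refl = refl

comp-≢ : ∀ {V : Set} (l : Lit V) → comp l ≢ l
comp-≢ (pos _) ()
comp-≢ (neg _) ()

isPartialAssignment-∷comp : ∀ {V : Set} {α : List (Lit V)} {l : Lit V} →
  IsPartialAssignment α → l ∉ α → IsPartialAssignment (comp l ∷ α)
isPartialAssignment-∷comp {l = l} _ _ _ (here refl) (here eq) = comp-≢ (comp l) eq
isPartialAssignment-∷comp {l = l} _ l∉α _ (here refl) (there p) =
  l∉α (subst (_∈ _) (comp-involutive l) p)
isPartialAssignment-∷comp _ l∉α _ (there p) (here eq) = l∉α (subst (_∈ _) (comp-injective eq) p)
isPartialAssignment-∷comp pa _ l′ (there p) (there q) = pa l′ p q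

not≡true⇒≡false : ∀ {b} → not b ≡ true → b ≡ false
not≡true⇒≡false {false} _ = refl

contraposeᵇ : ∀ {p q} → (p ≡ true → q ≡ true) → q ≡ false → p ≡ false
contraposeᵇ {false} _ _ = refl
contraposeᵇ {true} h refl with () ← h refl

∨≡true⁻ : ∀ {p q} → p ∨ q ≡ true → p ≡ true ⊎ q ≡ true
∨≡true⁻ {true} _ = inj₁ refl
∨≡true⁻ {false} h = inj₂ h

does≡true⁻ : ∀ {P : Set} (p? : Dec P) → does p? ≡ true → P
does≡true⁻ (yes p) _ = p

map-allFin′ : ∀ {A : Set} k (f : Fin k → A) → map f (allFin′ k) ≡ tabulate f
map-allFin′ zero f = refl
map-allFin′ (suc k) f =
  cong (f zero ∷_) (trans (sym (map-∘ (allFin′ k))) (map-allFin′ k (λ i → f (suc i))))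

Unique-All≡⇒singleton : ∀ {A : Set} {a : A} {as : List A} →
  Unique as → All (_≡ a) as → a ∈ as → as ≡ a ∷ []
Unique-All≡⇒singleton {as = _ ∷ []} _ (refl ∷ []) _ = refl
Unique-All≡⇒singleton {as = _ ∷ _ ∷ _} ((b≢c ∷ _) ∷ _) (refl ∷ refl ∷ _) _ = ⊥-elim (b≢c refl)

length-tabulate-++ : ∀ {A : Set} {k} (f : Fin k → A) ys → length (tabulate f ++ ys) ≡ k + length ys
length-tabulate-++ f ys = trans (length-++ (tabulate f)) (cong (_+ length ys) (length-tabulate f))

module _ {V : Set} (σ : V → Bool) where

  evalLit-comp : ∀ l → evalLit σ l ≡ true → evalLit σ (comp l) ≡ true → ⊥
  evalLit-comp (pos v) p q with () ← trans (sym (cong not p)) q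
  evalLit-comp (neg v) p q with () ← trans (sym (cong not q)) p

  evalClause-Any⁺ : ∀ {C} → Any (λ l → evalLit σ l ≡ true) C → evalClause σ C ≡ true
  evalClause-Any⁺ (here p) rewrite p = refl
  evalClause-Any⁺ {l ∷ _} (there p) rewrite evalClause-Any⁺ p = ∨-zeroʳ (evalLit σ l)

  evalClause-Any⁻ : ∀ {C} → evalClause σ C ≡ true → Any (λ l → evalLit σ l ≡ true) C
  evalClause-Any⁻ {l ∷ _} h with evalLit σ l in eq
  ... | true = here eq
  ... | false = there (evalClause-Any⁻ h)

  evalCNF-All⁺ : ∀ {φ} → All (λ C → evalClause σ C ≡ true) φ → evalCNF σ φ ≡ true
  evalCNF-All⁺ [] = refl
  evalCNF-All⁺ (p ∷ ps) rewrite p = evalCNF-All⁺ ps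

  evalCNF-All⁻ : ∀ {φ} → evalCNF σ φ ≡ true → All (λ C → evalClause σ C ≡ true) φ
  evalCNF-All⁻ {[]} _ = []
  evalCNF-All⁻ {C ∷ _} h with evalClause σ C in eq
  evalCNF-All⁻ {C ∷ _} h  | true = eq ∷ evalCNF-All⁻ h
  evalCNF-All⁻ {C ∷ _} () | false

  evalClause-neg∷⁺ : ∀ {u C} → (σ u ≡ true → evalClause σ C ≡ true) →
                     evalClause σ (neg u ∷ C) ≡ true
  evalClause-neg∷⁺ {u} h with σ u
  ... | false = refl
  ... | true  = h refl

  evalClause-neg∷⁻ : ∀ {u C} → evalClause σ (neg u ∷ C) ≡ true →
                     σ u ≡ true → evalClause σ C ≡ true
  evalClause-neg∷⁻ {C = C} h σu = subst (λ b → not b ∨ evalClause σ C ≡ true) σu h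

  evalClause-[pos]⁺ : ∀ {v} → σ v ≡ true → evalClause σ (pos v ∷ []) ≡ true
  evalClause-[pos]⁺ σv rewrite σv = refl

  evalClause-[pos]⁻ : ∀ {v} → evalClause σ (pos v ∷ []) ≡ true → σ v ≡ true
  evalClause-[pos]⁻ {v} = trans (sym (∨-identityʳ (σ v)))

  evalClause-⇒⁺ : ∀ {u v} → (σ u ≡ true → σ v ≡ true) →
                  evalClause σ (neg u ∷ pos v ∷ []) ≡ true
  evalClause-⇒⁺ {u} {v} h = evalClause-neg∷⁺ {u} {pos v ∷ []} λ σu → evalClause-[pos]⁺ {v} (h σu)

  evalClause-⇒⁻ : ∀ {u v} → evalClause σ (neg u ∷ pos v ∷ []) ≡ true →
                  σ u ≡ true → σ v ≡ true
  evalClause-⇒⁻ {u} {v} h σu = evalClause-[pos]⁻ {v} (evalClause-neg∷⁻ {u} {pos v ∷ []} h σu)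

  evalClause-⇒₂⁺ : ∀ {u v w} → (σ u ≡ true → σ v ≡ true → σ w ≡ true) →
                   evalClause σ (neg u ∷ neg v ∷ pos w ∷ []) ≡ true
  evalClause-⇒₂⁺ {u} {v} {w} h = evalClause-neg∷⁺ {u} {neg v ∷ pos w ∷ []} λ σu →
    evalClause-neg∷⁺ {v} {pos w ∷ []} λ σv → evalClause-[pos]⁺ {w} (h σu σv)

  evalClause-⇒₂⁻ : ∀ {u v w} → evalClause σ (neg u ∷ neg v ∷ pos w ∷ []) ≡ true →
                   σ u ≡ true → σ v ≡ true → σ w ≡ true
  evalClause-⇒₂⁻ {u} {v} {w} h σu σv =
    evalClause-[pos]⁻ {w}
      (evalClause-neg∷⁻ {v} {pos w ∷ []} (evalClause-neg∷⁻ {u} {neg v ∷ pos w ∷ []} h σu) σv)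

  evalClause-⇒∃⁺ : ∀ {k u} {f : Fin k → V} → (σ u ≡ true → ∃ λ i → σ (f i) ≡ false) →
                   evalClause σ (neg u ∷ tabulate (λ i → neg (f i))) ≡ true
  evalClause-⇒∃⁺ {u = u} {f} h = evalClause-neg∷⁺ {u} {tabulate (λ i → neg (f i))} λ σu →
    let i , σfi = h σu
    in evalClause-Any⁺ (AnyP.tabulate⁺ {f = λ i → neg (f i)} i (cong not σfi))

  evalClause-⇒∃⁻ : ∀ {k u} {f : Fin k → V} →
                   evalClause σ (neg u ∷ tabulate (λ i → neg (f i))) ≡ true →
                   σ u ≡ true → ∃ λ i → σ (f i) ≡ false
  evalClause-⇒∃⁻ {u = u} {f} h σu =
    let i , ¬σfi = AnyP.tabulate⁻ {f = λ i → neg (f i)}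
                     (evalClause-Any⁻ (evalClause-neg∷⁻ {u} {tabulate (λ i → neg (f i))} h σu))
    in i , not≡true⇒≡false ¬σfi

module UnitPropagation {V : Set} (_≟ᵛ_ : DecidableEquality V) (Φ : CNF V)
                       (Φ-unique : All Unique Φ) where

  _≟_ : DecidableEquality (Lit V)
  _≟_ = litDec _≟ᵛ_

  ⊢_ : Clause V → Set
  ⊢_ = Derives _≟_ Φ

  ⊢₁_ : Lit V → Set
  ⊢₁ l = ⊢ (l ∷ [])

  ⊢₁⇒derivesLit : ∀ {l} → ⊢₁ l → DerivesLit _≟_ Φ l
  ⊢₁⇒derivesLit ⊢l = _ ∷ [] , ⊢l , here refl , refl ∷ []

  derived-unique : ∀ {C} → ⊢ C → Unique C
  derived-unique (axiom C∈Φ) = All.lookup Φ-unique C∈Φ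
  derived-unique (unitRes {l = l} ⊢C _ _) =
    UniqueP.filter⁺ (λ l′ → ¬? (l′ ≟ l)) (derived-unique ⊢C)

  remove-shrinks : ∀ {r C} → r ∈ C → length (remove _≟_ r C) < length C
  remove-shrinks {r} {C} r∈C =
    filter-notAll (λ l → ¬? (l ≟ r)) C (Any.map (λ { refl ¬r≡r → ¬r≡r refl }) r∈C)

  ∈-remove⁻ : ∀ {l r C} → l ∈ remove _≟_ r C → l ∈ C
  ∈-remove⁻ {r = r} l∈ = proj₁ (∈-filter⁻ (λ l′ → ¬? (l′ ≟ r)) l∈)

  ∈-remove⁺ : ∀ {l r C} → l ∈ C → l ≢ r → l ∈ remove _≟_ r C
  ∈-remove⁺ {r = r} = ∈-filter⁺ (λ l′ → ¬? (l′ ≟ r))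

  resolve-outside : (K : Pred (Lit V) 0ℓ) → Decidable K → ∀ fuel {C} → length C ≤ fuel → ⊢ C →
    (∀ {l} → l ∈ C → ¬ K l → ⊢₁ comp l) →
    ∃ λ C′ → ⊢ C′ × All K C′ × (∀ {l} → l ∈ C → K l → l ∈ C′)
  resolve-outside K K? zero {[]} _ ⊢C _ = [] , ⊢C , [] , λ ()
  resolve-outside K K? (suc fuel) {C} |C|≤fuel ⊢C ⊢comp with All.all? K? C
  ... | yes all-K = C , ⊢C , all-K , λ l∈C _ → l∈C
  ... | no ¬all-K with r , r∈C , ¬Kr ← find (¬All⇒Any¬ K? C ¬all-K)
    with C′ , ⊢C′ , all-K , kept ← resolve-outside K K? fuel
           (≤-pred (≤-trans (remove-shrinks r∈C) |C|≤fuel))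
           (unitRes ⊢C r∈C (⊢comp r∈C ¬Kr))
           (λ l∈C′ → ⊢comp (∈-remove⁻ l∈C′))
    = C′ , ⊢C′ , all-K , λ l∈C Kl → kept (∈-remove⁺ l∈C λ { refl → ¬Kr Kl }) Kl

  unit-propagate : ∀ {C l} → ⊢ C → l ∈ C → All (λ l′ → l′ ≡ l ⊎ ⊢₁ comp l′) C → ⊢₁ l
  unit-propagate {C} {l} ⊢C l∈C side =
    let C′ , ⊢C′ , all≡l , kept = resolve-outside (_≡ l) (_≟ l) (length C) ≤-refl ⊢C other
    in subst ⊢_ (Unique-All≡⇒singleton (derived-unique ⊢C′) all≡l (kept l∈C refl)) ⊢C′
    where
    other : ∀ {l′} → l′ ∈ C → l′ ≢ l → ⊢₁ comp l′
    other l′∈C l′≢l with All.lookup side l′∈C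
    ... | inj₁ l′≡l = ⊥-elim (l′≢l l′≡l)
    ... | inj₂ ⊢comp = ⊢comp

  refute : ∀ {C} → ⊢ C → All (λ l → ⊢₁ comp l) C → ⊢ []
  refute {C} ⊢C ⊢comps =
    let C′ , ⊢C′ , none , _ = resolve-outside (λ _ → ⊥) (λ _ → no λ ()) (length C) ≤-refl ⊢C
                                (λ l∈C _ → All.lookup ⊢comps l∈C)
    in subst ⊢_ (empty none) ⊢C′
    where
    empty : ∀ {D : Clause V} → All (λ _ → ⊥) D → D ≡ []
    empty [] = refl

  clash : ∀ {l} → ⊢₁ l → ⊢₁ comp l → ⊢ []
  clash ⊢l ⊢¬l = refute ⊢l (⊢¬l ∷ [])

  binary⁺ : ∀ {l₁ l₂} → ⊢ (l₁ ∷ l₂ ∷ []) → ⊢₁ comp l₁ → ⊢₁ l₂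
  binary⁺ ⊢C ⊢¬l₁ = unit-propagate ⊢C (there (here refl)) (inj₂ ⊢¬l₁ ∷ inj₁ refl ∷ [])

  binary⁻ : ∀ {l₁ l₂} → ⊢ (l₁ ∷ l₂ ∷ []) → ⊢₁ comp l₂ → ⊢₁ l₁
  binary⁻ ⊢C ⊢¬l₂ = unit-propagate ⊢C (here refl) (inj₁ refl ∷ inj₂ ⊢¬l₂ ∷ [])

psi≡tabulate : ∀ n → psi n ≡
     tabulate (λ i → neg (x (inject₁ i)) ∷ neg (y i) ∷ pos (z i) ∷ [])
  ++ (neg (x (fromℕ n)) ∷ tabulate (λ i → neg (z i))) ∷ []
  ++ tabulate (λ i → neg (x (inject₁ i)) ∷ pos (x (suc i)) ∷ [])
  ++ (neg (x (fromℕ n)) ∷ pos (x zero) ∷ []) ∷ []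
psi≡tabulate n = cong₂ _++_ (map-allFin′ n _)
  (cong₂ _∷_ (cong (neg (x (fromℕ n)) ∷_) (map-allFin′ n _))
         (cong (_++ (neg (x (fromℕ n)) ∷ pos (x zero) ∷ []) ∷ []) (map-allFin′ n _)))

record IsPsiModel {n : ℕ} (a : PsiVar n → Bool) : Set where
  field
    x∧y⇒z     : ∀ i → a (x (inject₁ i)) ≡ true → a (y i) ≡ true → a (z i) ≡ true
    xₘ⇒some¬z : a (x (fromℕ n)) ≡ true → ∃ λ i → a (z i) ≡ false
    x⇒next    : ∀ i → a (x (inject₁ i)) ≡ true → a (x (suc i)) ≡ true
    xₘ⇒x₁     : a (x (fromℕ n)) ≡ true → a (x zero) ≡ true

module _ {n : ℕ} {a : PsiVar n → Bool} where

  isPsiModel⁺ : IsPsiModel a → evalCNF a (psi n) ≡ true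
  isPsiModel⁺ m = subst (λ φ → evalCNF a φ ≡ true) (sym (psi≡tabulate n)) (evalCNF-All⁺ a
      (AllP.++⁺ (AllP.tabulate⁺ λ i → evalClause-⇒₂⁺ a (x∧y⇒z i))
      (evalClause-⇒∃⁺ a xₘ⇒some¬z ∷
       AllP.++⁺ (AllP.tabulate⁺ λ i → evalClause-⇒⁺ a (x⇒next i))
      (evalClause-⇒⁺ a xₘ⇒x₁ ∷ []))))
    where open IsPsiModel m

  isPsiModel⁻ : evalCNF a (psi n) ≡ true → IsPsiModel a
  isPsiModel⁻ h
    with ps₁ , p₂ ∷ rest ← AllP.++⁻ (tabulate _) {_ ∷ _}
                             (evalCNF-All⁻ a (subst (λ φ → evalCNF a φ ≡ true) (psi≡tabulate n) h))
    with ps₃ , p₄ ∷ [] ← AllP.++⁻ (tabulate _) {_ ∷ []} rest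
    = record
    { x∧y⇒z     = λ i → evalClause-⇒₂⁻ a (AllP.tabulate⁻ ps₁ i)
    ; xₘ⇒some¬z = evalClause-⇒∃⁻ a p₂
    ; x⇒next    = λ i → evalClause-⇒⁻ a (AllP.tabulate⁻ ps₃ i)
    ; xₘ⇒x₁     = evalClause-⇒⁻ a p₄
    }

  x-constant : IsPsiModel a → ∀ j → a (x j) ≡ a (x zero)
  x-constant m j with a (x zero) in eq
  ... | true  = <-weakInduction (λ i → a (x i) ≡ true) eq (IsPsiModel.x⇒next m) j
  ... | false = >-weakInduction (λ i → a (x i) ≡ false) (contraposeᵇ (IsPsiModel.xₘ⇒x₁ m) eq)
                  (λ i → contraposeᵇ (IsPsiModel.x⇒next m i)) j

clause-count : ∀ n → suc n + (suc n + (n + (n + (n + 1)))) + 2 ≡ 5 * suc n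
clause-count = solve-∀

module Encoding (n : ℕ) where

  Var : Set
  Var = PsiVar n ⊎ Fin (suc n)

  _≟ᵛ_ : DecidableEquality Var
  _≟ᵛ_ = ≡-dec psiVarDec _≟F_

  L : Set
  L = Lit Var

  open import Data.List.Membership.DecPropositional (litDec _≟ᵛ_) using (_∈?_)

  xᵛ : Fin (suc n) → Var
  xᵛ i = inj₁ (x i)

  yᵛ zᵛ aᵛ : Fin n → Var
  yᵛ i = inj₁ (y i)
  zᵛ i = inj₁ (z i)
  aᵛ i = inj₂ (suc i)

  eᵛ : Var
  eᵛ = inj₂ zero

  [x⇒e] [e⇒x] : Fin (suc n) → Clause Var
  [x⇒e] i = neg (xᵛ i) ∷ pos eᵛ ∷ []
  [e⇒x] i = neg eᵛ ∷ pos (xᵛ i) ∷ []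

  [y⇒a] [z⇒a] [e∧a⇒z] : Fin n → Clause Var
  [y⇒a] i = neg (yᵛ i) ∷ pos (aᵛ i) ∷ []
  [z⇒a] i = neg (zᵛ i) ∷ pos (aᵛ i) ∷ []
  [e∧a⇒z] i = neg eᵛ ∷ neg (aᵛ i) ∷ pos (zᵛ i) ∷ []

  [e⇒some¬a] : Clause Var
  [e⇒some¬a] = neg eᵛ ∷ tabulate (λ i → neg (aᵛ i))

  enc : CNF Var
  enc = tabulate [x⇒e] ++ tabulate [e⇒x] ++ tabulate [y⇒a] ++ tabulate [z⇒a]
     ++ tabulate [e∧a⇒z] ++ [e⇒some¬a] ∷ []

  all-enc : {P : Clause Var → Set} →
    (∀ i → P ([x⇒e] i)) → (∀ i → P ([e⇒x] i)) → (∀ i → P ([y⇒a] i)) → (∀ i → P ([z⇒a] i)) →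
    (∀ i → P ([e∧a⇒z] i)) → P [e⇒some¬a] → All P enc
  all-enc p₁ p₂ p₃ p₄ p₅ p₆ =
    AllP.++⁺ (AllP.tabulate⁺ p₁) (AllP.++⁺ (AllP.tabulate⁺ p₂) (AllP.++⁺ (AllP.tabulate⁺ p₃)
    (AllP.++⁺ (AllP.tabulate⁺ p₄) (AllP.++⁺ (AllP.tabulate⁺ p₅) (p₆ ∷ [])))))

  [x⇒e]∈enc : ∀ i → [x⇒e] i ∈ enc
  [x⇒e]∈enc i = ∈-++⁺ˡ (∈-tabulate⁺ {f = [x⇒e]} i)

  [e⇒x]∈enc : ∀ i → [e⇒x] i ∈ enc
  [e⇒x]∈enc i = ∈-++⁺ʳ (tabulate [x⇒e]) (∈-++⁺ˡ (∈-tabulate⁺ {f = [e⇒x]} i))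

  [y⇒a]∈enc : ∀ i → [y⇒a] i ∈ enc
  [y⇒a]∈enc i = ∈-++⁺ʳ (tabulate [x⇒e]) (∈-++⁺ʳ (tabulate [e⇒x])
    (∈-++⁺ˡ (∈-tabulate⁺ {f = [y⇒a]} i)))

  [z⇒a]∈enc : ∀ i → [z⇒a] i ∈ enc
  [z⇒a]∈enc i = ∈-++⁺ʳ (tabulate [x⇒e]) (∈-++⁺ʳ (tabulate [e⇒x]) (∈-++⁺ʳ (tabulate [y⇒a])
    (∈-++⁺ˡ (∈-tabulate⁺ {f = [z⇒a]} i))))

  [e∧a⇒z]∈enc : ∀ i → [e∧a⇒z] i ∈ enc
  [e∧a⇒z]∈enc i = ∈-++⁺ʳ (tabulate [x⇒e]) (∈-++⁺ʳ (tabulate [e⇒x]) (∈-++⁺ʳ (tabulate [y⇒a])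
    (∈-++⁺ʳ (tabulate [z⇒a]) (∈-++⁺ˡ (∈-tabulate⁺ {f = [e∧a⇒z]} i)))))

  [e⇒some¬a]∈enc : [e⇒some¬a] ∈ enc
  [e⇒some¬a]∈enc = ∈-++⁺ʳ (tabulate [x⇒e]) (∈-++⁺ʳ (tabulate [e⇒x]) (∈-++⁺ʳ (tabulate [y⇒a])
    (∈-++⁺ʳ (tabulate [z⇒a]) (∈-++⁺ʳ (tabulate [e∧a⇒z]) (here refl)))))

  enc-unique : All Unique enc
  enc-unique = all-enc (λ _ → neg∷pos) (λ _ → neg∷pos) (λ _ → neg∷pos) (λ _ → neg∷pos)
    (λ _ → ((λ ()) ∷ (λ ()) ∷ []) ∷ ((λ ()) ∷ []) ∷ [] ∷ [])
    (AllP.tabulate⁺ (λ _ ()) ∷ UniqueP.tabulate⁺ λ { refl → refl })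
    where
    neg∷pos : ∀ {u v} → Unique (neg u ∷ pos v ∷ [])
    neg∷pos = ((λ ()) ∷ []) ∷ [] ∷ []

  record IsEncModel (σ : Var → Bool) : Set where
    field
      x⇒e      : ∀ i → σ (xᵛ i) ≡ true → σ eᵛ ≡ true
      e⇒x      : ∀ i → σ eᵛ ≡ true → σ (xᵛ i) ≡ true
      y⇒a      : ∀ i → σ (yᵛ i) ≡ true → σ (aᵛ i) ≡ true
      z⇒a      : ∀ i → σ (zᵛ i) ≡ true → σ (aᵛ i) ≡ true
      e∧a⇒z    : ∀ i → σ eᵛ ≡ true → σ (aᵛ i) ≡ true → σ (zᵛ i) ≡ true
      e⇒some¬a : σ eᵛ ≡ true → ∃ λ i → σ (aᵛ i) ≡ false

  isEncModel⁺ : ∀ {σ} → IsEncModel σ → evalCNF σ enc ≡ true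
  isEncModel⁺ {σ} m = evalCNF-All⁺ σ (all-enc
    (λ i → evalClause-⇒⁺ σ (x⇒e i)) (λ i → evalClause-⇒⁺ σ (e⇒x i))
    (λ i → evalClause-⇒⁺ σ (y⇒a i)) (λ i → evalClause-⇒⁺ σ (z⇒a i))
    (λ i → evalClause-⇒₂⁺ σ (e∧a⇒z i)) (evalClause-⇒∃⁺ σ e⇒some¬a))
    where open IsEncModel m

  isEncModel⁻ : ∀ {σ} → evalCNF σ enc ≡ true → IsEncModel σ
  isEncModel⁻ {σ} h = record
    { x⇒e      = λ i → evalClause-⇒⁻ σ (holds ([x⇒e]∈enc i))
    ; e⇒x      = λ i → evalClause-⇒⁻ σ (holds ([e⇒x]∈enc i))
    ; y⇒a      = λ i → evalClause-⇒⁻ σ (holds ([y⇒a]∈enc i))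
    ; z⇒a      = λ i → evalClause-⇒⁻ σ (holds ([z⇒a]∈enc i))
    ; e∧a⇒z    = λ i → evalClause-⇒₂⁻ σ (holds ([e∧a⇒z]∈enc i))
    ; e⇒some¬a = evalClause-⇒∃⁻ σ (holds [e⇒some¬a]∈enc)
    }
    where holds = All.lookup (evalCNF-All⁻ σ h)

  size-enc : size enc + 2 ≡ 5 * suc n
  size-enc = begin
    length enc + 2                                 ≡⟨ cong (_+ 2) length-enc ⟩
    suc n + (suc n + (n + (n + (n + 1)))) + 2      ≡⟨ clause-count n ⟩
    5 * suc n                                      ∎
    where
    open ≡-Reasoning
    length-enc : length enc ≡ suc n + (suc n + (n + (n + (n + 1))))
    length-enc =
      trans (length-tabulate-++ [x⇒e] _) (cong (suc n +_)
      (trans (length-tabulate-++ [e⇒x] _) (cong (suc n +_)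
      (trans (length-tabulate-++ [y⇒a] _) (cong (n +_)
      (trans (length-tabulate-++ [z⇒a] _) (cong (n +_)
      (length-tabulate-++ [e∧a⇒z] _))))))))

  auxiliary : (PsiVar n → Bool) → Fin (suc n) → Bool
  auxiliary a zero    = a (x zero)
  auxiliary a (suc i) = a (y i) ∨ a (z i)

  psiModel⇒encModel : ∀ {a} → IsPsiModel a → IsEncModel (join a (auxiliary a))
  psiModel⇒encModel {a} m = record
    { x⇒e      = λ i → trans (sym (x-constant m i))
    ; e⇒x      = λ i → trans (x-constant m i)
    ; y⇒a      = λ i → cong (_∨ a (z i))
    ; z⇒a      = λ i a-z → trans (cong (a (y i) ∨_) a-z) (∨-zeroʳ (a (y i)))
    ; e∧a⇒z    = λ i a-x₁ a-y∨z → [ x∧y⇒z i (x-at a-x₁ (inject₁ i)) , id ]′ (∨≡true⁻ a-y∨z)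
    ; e⇒some¬a = some¬y∧¬z
    }
    where
    open IsPsiModel m
    x-at : a (x zero) ≡ true → ∀ j → a (x j) ≡ true
    x-at a-x₁ j = trans (x-constant m j) a-x₁
    some¬y∧¬z : a (x zero) ≡ true → ∃ λ i → a (y i) ∨ a (z i) ≡ false
    some¬y∧¬z a-x₁ with i , ¬z ← xₘ⇒some¬z (x-at a-x₁ (fromℕ n)) =
      i , cong₂ _∨_ (contraposeᵇ (x∧y⇒z i (x-at a-x₁ (inject₁ i))) ¬z) ¬z

  encModel⇒psiModel : ∀ {a b} → IsEncModel (join a b) → IsPsiModel a
  encModel⇒psiModel m = record
    { x∧y⇒z     = λ i a-x a-y → e∧a⇒z i (x⇒e (inject₁ i) a-x) (y⇒a i a-y)
    ; xₘ⇒some¬z = λ a-x → let i , ¬a = e⇒some¬a (x⇒e (fromℕ n) a-x)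
                           in i , contraposeᵇ (z⇒a i) ¬a
    ; x⇒next    = λ i a-x → e⇒x (suc i) (x⇒e (inject₁ i) a-x)
    ; xₘ⇒x₁     = λ a-x → e⇒x zero (x⇒e (fromℕ n) a-x)
    }
    where open IsEncModel m

  encodes : IsEncoding (λ a → evalCNF a (psi n)) enc
  encodes a = (λ h → auxiliary a , isEncModel⁺ (psiModel⇒encModel (isPsiModel⁻ h)))
            , (λ (_ , h) → isPsiModel⁺ (encModel⇒psiModel (isEncModel⁻ h)))

  data ForcesE : L → Set where
    by-e : ForcesE (pos eᵛ)
    by-x : ∀ i → ForcesE (pos (xᵛ i))

  data ForcesNotE : L → Set where
    by-¬e : ForcesNotE (neg eᵛ)
    by-¬x : ∀ i → ForcesNotE (neg (xᵛ i))

  data ForcesA (i : Fin n) : L → Set where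
    by-a : ForcesA i (pos (aᵛ i))
    by-y : ForcesA i (pos (yᵛ i))
    by-z : ForcesA i (pos (zᵛ i))

  data ForcesNotZ (i : Fin n) : L → Set where
    by-¬a : ForcesNotZ i (neg (aᵛ i))
    by-¬z : ForcesNotZ i (neg (zᵛ i))

  forcesE? : Decidable ForcesE
  forcesE? (pos (inj₁ (x i)))     = yes (by-x i)
  forcesE? (pos (inj₁ (y _)))     = no λ ()
  forcesE? (pos (inj₁ (z _)))     = no λ ()
  forcesE? (pos (inj₂ zero))      = yes by-e
  forcesE? (pos (inj₂ (suc _)))   = no λ ()
  forcesE? (neg _)                = no λ ()

  forcesNotE? : Decidable ForcesNotE
  forcesNotE? (neg (inj₁ (x i)))   = yes (by-¬x i)
  forcesNotE? (neg (inj₁ (y _)))   = no λ ()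
  forcesNotE? (neg (inj₁ (z _)))   = no λ ()
  forcesNotE? (neg (inj₂ zero))    = yes by-¬e
  forcesNotE? (neg (inj₂ (suc _))) = no λ ()
  forcesNotE? (pos _)              = no λ ()

  forcesA? : ∀ i → Decidable (ForcesA i)
  forcesA? i (pos (inj₁ (x _)))   = no λ ()
  forcesA? i (pos (inj₁ (y j))) with j ≟F i
  ... | yes refl = yes by-y
  ... | no j≢i   = no λ { by-y → j≢i refl }
  forcesA? i (pos (inj₁ (z j))) with j ≟F i
  ... | yes refl = yes by-z
  ... | no j≢i   = no λ { by-z → j≢i refl }
  forcesA? i (pos (inj₂ zero))    = no λ ()
  forcesA? i (pos (inj₂ (suc j))) with j ≟F i
  ... | yes refl = yes by-a
  ... | no j≢i   = no λ { by-a → j≢i refl }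
  forcesA? i (neg _)              = no λ ()

  forcesNotZ? : ∀ i → Decidable (ForcesNotZ i)
  forcesNotZ? i (neg (inj₁ (x _)))   = no λ ()
  forcesNotZ? i (neg (inj₁ (y _)))   = no λ ()
  forcesNotZ? i (neg (inj₁ (z j))) with j ≟F i
  ... | yes refl = yes by-¬z
  ... | no j≢i   = no λ { by-¬z → j≢i refl }
  forcesNotZ? i (neg (inj₂ zero))    = no λ ()
  forcesNotZ? i (neg (inj₂ (suc j))) with j ≟F i
  ... | yes refl = yes by-¬a
  ... | no j≢i   = no λ { by-¬a → j≢i refl }
  forcesNotZ? i (pos _)              = no λ ()

  forcesE⇒¬forcesNotE : ∀ {l} → ForcesE l → ¬ ForcesNotE l
  forcesE⇒¬forcesNotE by-e ()
  forcesE⇒¬forcesNotE (by-x _) ()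

  forcesE⇒¬forcesA : ∀ {i l} → ForcesE l → ¬ ForcesA i l
  forcesE⇒¬forcesA by-e ()
  forcesE⇒¬forcesA (by-x _) ()

  forcesE⇒¬forcesNotZ : ∀ {i l} → ForcesE l → ¬ ForcesNotZ i l
  forcesE⇒¬forcesNotZ by-e ()
  forcesE⇒¬forcesNotZ (by-x _) ()

  forcesA⇒¬forcesNotZ : ∀ {i l} → ForcesA i l → ¬ ForcesNotZ i l
  forcesA⇒¬forcesNotZ by-a ()
  forcesA⇒¬forcesNotZ by-y ()
  forcesA⇒¬forcesNotZ by-z ()

  forcesA-unique : ∀ {i j l} → ForcesA i l → ForcesA j l → i ≡ j
  forcesA-unique by-a by-a = refl
  forcesA-unique by-y by-y = refl
  forcesA-unique by-z by-z = refl

  data Refutation (β : List L) : Set where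
    e-clash : Any ForcesE β → Any ForcesNotE β → Refutation β
    z-clash : ∀ i → Any ForcesE β → Any (ForcesA i) β → Any (ForcesNotZ i) β → Refutation β
    all-a   : Any ForcesE β → (∀ i → Any (ForcesA i) β) → Refutation β
    a-clash : ∀ i → Any (ForcesA i) β → neg (aᵛ i) ∈ β → Refutation β

  anyForcesA? : ∀ i β → Dec (Any (ForcesA i) β)
  anyForcesA? i = Any.any? (forcesA? i)

  Models : (Var → Bool) → List L → Set
  Models σ β = evalCNF σ enc ≡ true × All (λ l → evalLit σ l ≡ true) β

  eTrueModel : List L → Var → Bool
  eTrueModel β (inj₁ (x _))   = true
  eTrueModel β (inj₁ (y i))   = does (pos (yᵛ i) ∈? β)
  eTrueModel β (inj₁ (z i))   = does (anyForcesA? i β)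
  eTrueModel β (inj₂ zero)    = true
  eTrueModel β (inj₂ (suc i)) = does (anyForcesA? i β)

  eTrueModel-models : ∀ {β} → IsPartialAssignment β → ¬ Any ForcesNotE β →
    (∀ i → Any (ForcesA i) β → ¬ Any (ForcesNotZ i) β) → ∀ j → ¬ Any (ForcesA j) β →
    Models (eTrueModel β) β
  eTrueModel-models {β} pa ¬NE A⇒¬NZ j ¬Aj = isEncModel⁺ {eTrueModel β} (record
    { x⇒e      = λ _ _ → refl
    ; e⇒x      = λ _ _ → refl
    ; y⇒a      = λ i y∈β → dec-true (anyForcesA? i β) (lose (does≡true⁻ (pos (yᵛ i) ∈? β) y∈β) by-y)
    ; z⇒a      = λ _ → id
    ; e∧a⇒z    = λ _ _ → id
    ; e⇒some¬a = λ _ → j , dec-false (anyForcesA? j β) ¬Aj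
    }) , All.tabulate holds
    where
    ¬A : ∀ {i l} → ForcesNotZ i l → l ∈ β → ¬ Any (ForcesA i) β
    ¬A {i} NZ l∈β A = A⇒¬NZ i A (lose l∈β NZ)
    holds : ∀ {l} → l ∈ β → evalLit (eTrueModel β) l ≡ true
    holds {pos (inj₁ (x _))}   _   = refl
    holds {pos (inj₁ (y i))}   l∈β = dec-true (pos (yᵛ i) ∈? β) l∈β
    holds {pos (inj₁ (z i))}   l∈β = dec-true (anyForcesA? i β) (lose l∈β by-z)
    holds {pos (inj₂ zero)}    _   = refl
    holds {pos (inj₂ (suc i))} l∈β = dec-true (anyForcesA? i β) (lose l∈β by-a)
    holds {neg (inj₁ (x i))}   l∈β = ⊥-elim (¬NE (lose l∈β (by-¬x i)))
    holds {neg (inj₁ (y i))}   l∈β = cong not (dec-false (pos (yᵛ i) ∈? β) (pa _ l∈β))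
    holds {neg (inj₁ (z i))}   l∈β = cong not (dec-false (anyForcesA? i β) (¬A by-¬z l∈β))
    holds {neg (inj₂ zero)}    l∈β = ⊥-elim (¬NE (lose l∈β by-¬e))
    holds {neg (inj₂ (suc i))} l∈β = cong not (dec-false (anyForcesA? i β) (¬A by-¬a l∈β))

  eFalseModel : List L → Var → Bool
  eFalseModel β (inj₁ (x _))   = false
  eFalseModel β (inj₁ (y i))   = does (pos (yᵛ i) ∈? β)
  eFalseModel β (inj₁ (z i))   = does (pos (zᵛ i) ∈? β)
  eFalseModel β (inj₂ zero)    = false
  eFalseModel β (inj₂ (suc i)) = does (¬? (neg (aᵛ i) ∈? β))

  eFalseModel-models : ∀ {β} → IsPartialAssignment β → ¬ Any ForcesE β →
    (∀ i → Any (ForcesA i) β → neg (aᵛ i) ∉ β) → Models (eFalseModel β) β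
  eFalseModel-models {β} pa ¬E A⇒¬a∉β = isEncModel⁺ {eFalseModel β} (record
    { x⇒e      = λ _ ()
    ; e⇒x      = λ _ ()
    ; y⇒a      = λ i y∈β → dec-true (¬? (neg (aᵛ i) ∈? β))
                             (A⇒¬a∉β i (lose (does≡true⁻ (pos (yᵛ i) ∈? β) y∈β) by-y))
    ; z⇒a      = λ i z∈β → dec-true (¬? (neg (aᵛ i) ∈? β))
                             (A⇒¬a∉β i (lose (does≡true⁻ (pos (zᵛ i) ∈? β) z∈β) by-z))
    ; e∧a⇒z    = λ _ ()
    ; e⇒some¬a = λ ()
    }) , All.tabulate holds
    where
    holds : ∀ {l} → l ∈ β → evalLit (eFalseModel β) l ≡ true
    holds {pos (inj₁ (x i))}   l∈β = ⊥-elim (¬E (lose l∈β (by-x i)))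
    holds {pos (inj₁ (y i))}   l∈β = dec-true (pos (yᵛ i) ∈? β) l∈β
    holds {pos (inj₁ (z i))}   l∈β = dec-true (pos (zᵛ i) ∈? β) l∈β
    holds {pos (inj₂ zero)}    l∈β = ⊥-elim (¬E (lose l∈β by-e))
    holds {pos (inj₂ (suc i))} l∈β = dec-true (¬? (neg (aᵛ i) ∈? β)) (pa _ l∈β)
    holds {neg (inj₁ (x _))}   _   = refl
    holds {neg (inj₁ (y i))}   l∈β = cong not (dec-false (pos (yᵛ i) ∈? β) (pa _ l∈β))
    holds {neg (inj₁ (z i))}   l∈β = cong not (dec-false (pos (zᵛ i) ∈? β) (pa _ l∈β))
    holds {neg (inj₂ zero)}    _   = refl
    holds {neg (inj₂ (suc i))} l∈β = cong not (dec-false (¬? (neg (aᵛ i) ∈? β)) λ ¬a∉β → ¬a∉β l∈β)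

  refutation-or-model : ∀ {β} → IsPartialAssignment β → Refutation β ⊎ ∃ λ σ → Models σ β
  refutation-or-model {β} pa with Any.any? forcesE? β
  ... | no ¬E with any? (λ i → anyForcesA? i β ×-dec (neg (aᵛ i) ∈? β))
  ...   | yes (i , A , ¬a∈β) = inj₁ (a-clash i A ¬a∈β)
  ...   | no ¬clash = inj₂ (_ , eFalseModel-models pa ¬E λ i A ¬a∈β → ¬clash (i , A , ¬a∈β))
  refutation-or-model {β} pa | yes E with Any.any? forcesNotE? β
  ... | yes NE = inj₁ (e-clash E NE)
  ... | no ¬NE with any? (λ i → anyForcesA? i β ×-dec Any.any? (forcesNotZ? i) β)
  ...   | yes (i , A , NZ) = inj₁ (z-clash i E A NZ)
  ...   | no ¬clash with all? (λ i → anyForcesA? i β)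
  ...     | yes all-A = inj₁ (all-a E all-A)
  ...     | no ¬all-A with j , ¬Aj ← ¬∀⟶∃¬ n _ (λ i → anyForcesA? i β) ¬all-A =
    inj₂ (_ , eTrueModel-models pa ¬NE (λ i A NZ → ¬clash (i , A , NZ)) j ¬Aj)

  module Propagation (α : List L) where

    open UnitPropagation _≟ᵛ_ (enc ∧ᵤ α)
      (AllP.++⁺ enc-unique (AllP.map⁺ (All.universal (λ _ → [] ∷ []) α))) public

    ⊢enc : ∀ {C} → C ∈ enc → ⊢ C
    ⊢enc C∈enc = axiom (∈-++⁺ˡ C∈enc)

    ⊢α : ∀ {l} → l ∈ α → ⊢₁ l
    ⊢α l∈α = axiom (∈-++⁺ʳ enc (∈-map⁺ (λ l → l ∷ []) l∈α))

    ⊢z : ∀ {i} → ⊢₁ pos eᵛ → ⊢₁ pos (aᵛ i) → ⊢₁ pos (zᵛ i)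
    ⊢z ⊢e ⊢a = unit-propagate (⊢enc ([e∧a⇒z]∈enc _)) (there (there (here refl)))
      (inj₂ ⊢e ∷ inj₂ ⊢a ∷ inj₁ refl ∷ [])

    ⊢¬a : ∀ {i} → ⊢₁ pos eᵛ → ⊢₁ neg (zᵛ i) → ⊢₁ neg (aᵛ i)
    ⊢¬a ⊢e ⊢¬z = unit-propagate (⊢enc ([e∧a⇒z]∈enc _)) (there (here refl))
      (inj₂ ⊢e ∷ inj₁ refl ∷ inj₂ ⊢¬z ∷ [])

    ⊢¬e : ∀ {i} → ⊢₁ pos (aᵛ i) → ⊢₁ neg (zᵛ i) → ⊢₁ neg eᵛ
    ⊢¬e ⊢a ⊢¬z = unit-propagate (⊢enc ([e∧a⇒z]∈enc _)) (here refl)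
      (inj₁ refl ∷ inj₂ ⊢a ∷ inj₂ ⊢¬z ∷ [])

    ⊢¬e-from-all-a : (∀ i → ⊢₁ pos (aᵛ i)) → ⊢₁ neg eᵛ
    ⊢¬e-from-all-a ⊢a = unit-propagate (⊢enc [e⇒some¬a]∈enc) (here refl)
      (inj₁ refl ∷ AllP.tabulate⁺ (λ i → inj₂ (⊢a i)))

    ⊢¬a-from-other-a : ∀ {j} → ⊢₁ pos eᵛ → (∀ i → i ≢ j → ⊢₁ pos (aᵛ i)) → ⊢₁ neg (aᵛ j)
    ⊢¬a-from-other-a {j} ⊢e ⊢a = unit-propagate (⊢enc [e⇒some¬a]∈enc)
      (there (∈-tabulate⁺ {f = λ i → neg (aᵛ i)} j)) (inj₂ ⊢e ∷ AllP.tabulate⁺ other)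
      where
      other : ∀ i → neg (aᵛ i) ≡ neg (aᵛ j) ⊎ ⊢₁ pos (aᵛ i)
      other i with i ≟F j
      ... | yes refl = inj₁ refl
      ... | no i≢j   = inj₂ (⊢a i i≢j)

    ⊢-forcesE : ∀ {l} → ForcesE l → ⊢₁ l → ⊢₁ pos eᵛ
    ⊢-forcesE by-e     = id
    ⊢-forcesE (by-x i) = binary⁺ (⊢enc ([x⇒e]∈enc i))

    ⊢comp-forcesE : ∀ {l} → ForcesE l → ⊢₁ neg eᵛ → ⊢₁ comp l
    ⊢comp-forcesE by-e     = id
    ⊢comp-forcesE (by-x i) = binary⁻ (⊢enc ([x⇒e]∈enc i))

    ⊢-forcesNotE : ∀ {l} → ForcesNotE l → ⊢₁ l → ⊢₁ neg eᵛ
    ⊢-forcesNotE by-¬e     = id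
    ⊢-forcesNotE (by-¬x i) = binary⁻ (⊢enc ([e⇒x]∈enc i))

    ⊢comp-forcesNotE : ∀ {l} → ForcesNotE l → ⊢₁ pos eᵛ → ⊢₁ comp l
    ⊢comp-forcesNotE by-¬e     = id
    ⊢comp-forcesNotE (by-¬x i) = binary⁺ (⊢enc ([e⇒x]∈enc i))

    ⊢-forcesA : ∀ {i l} → ForcesA i l → ⊢₁ l → ⊢₁ pos (aᵛ i)
    ⊢-forcesA by-a = id
    ⊢-forcesA by-y = binary⁺ (⊢enc ([y⇒a]∈enc _))
    ⊢-forcesA by-z = binary⁺ (⊢enc ([z⇒a]∈enc _))

    ⊢comp-forcesA : ∀ {i l} → ForcesA i l → ⊢₁ neg (aᵛ i) → ⊢₁ comp l
    ⊢comp-forcesA by-a = id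
    ⊢comp-forcesA by-y = binary⁻ (⊢enc ([y⇒a]∈enc _))
    ⊢comp-forcesA by-z = binary⁻ (⊢enc ([z⇒a]∈enc _))

    ⊢-forcesNotZ : ∀ {i l} → ForcesNotZ i l → ⊢₁ l → ⊢₁ neg (zᵛ i)
    ⊢-forcesNotZ by-¬a = binary⁻ (⊢enc ([z⇒a]∈enc _))
    ⊢-forcesNotZ by-¬z = id

    ⊢comp-forcesNotZ : ∀ {i l} → ForcesNotZ i l → ⊢₁ pos eᵛ → ⊢₁ pos (aᵛ i) → ⊢₁ comp l
    ⊢comp-forcesNotZ by-¬a _  = id
    ⊢comp-forcesNotZ by-¬z ⊢e = ⊢z ⊢e

    ⊢-witness : ∀ {P : Pred L 0ℓ} {t} → (∀ {l} → P l → ⊢₁ l → ⊢₁ t) → Any P α → ⊢₁ t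
    ⊢-witness forces p with _ , l∈α , Pl ← find p = forces Pl (⊢α l∈α)

    ⊢e-witness : Any ForcesE α → ⊢₁ pos eᵛ
    ⊢e-witness = ⊢-witness ⊢-forcesE

    ⊢¬e-witness : Any ForcesNotE α → ⊢₁ neg eᵛ
    ⊢¬e-witness = ⊢-witness ⊢-forcesNotE

    ⊢a-witness : ∀ {i} → Any (ForcesA i) α → ⊢₁ pos (aᵛ i)
    ⊢a-witness = ⊢-witness ⊢-forcesA

    ⊢¬z-witness : ∀ {i} → Any (ForcesNotZ i) α → ⊢₁ neg (zᵛ i)
    ⊢¬z-witness = ⊢-witness ⊢-forcesNotZ

    -- Each case splits on whether w is the witness of a literal of the pattern; the other
    -- witnesses then lie in α, since w cannot play two roles at once.
    refutation-propagates : ∀ {w} → Refutation (w ∷ α) → ⊢₁ comp w ⊎ ⊢ []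
    refutation-propagates (e-clash (here pw) q) =
      inj₁ (⊢comp-forcesE pw (⊢¬e-witness (Any.tail (forcesE⇒¬forcesNotE pw) q)))
    refutation-propagates (e-clash (there p) (here qw)) =
      inj₁ (⊢comp-forcesNotE qw (⊢e-witness p))
    refutation-propagates (e-clash (there p) (there q)) =
      inj₂ (clash (⊢e-witness p) (⊢¬e-witness q))
    refutation-propagates (z-clash i (here pw) q r) =
      inj₁ (⊢comp-forcesE pw (⊢¬e (⊢a-witness (Any.tail (forcesE⇒¬forcesA pw) q))
                                  (⊢¬z-witness (Any.tail (forcesE⇒¬forcesNotZ pw) r))))
    refutation-propagates (z-clash i (there p) (here qw) r) =
      inj₁ (⊢comp-forcesA qw (⊢¬a (⊢e-witness p)
                                  (⊢¬z-witness (Any.tail (forcesA⇒¬forcesNotZ qw) r))))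
    refutation-propagates (z-clash i (there p) (there q) (here rw)) =
      inj₁ (⊢comp-forcesNotZ rw (⊢e-witness p) (⊢a-witness q))
    refutation-propagates (z-clash i (there p) (there q) (there r)) =
      inj₂ (clash (⊢e-witness p) (⊢¬e (⊢a-witness q) (⊢¬z-witness r)))
    refutation-propagates (all-a (here pw) q) =
      inj₁ (⊢comp-forcesE pw (⊢¬e-from-all-a λ i →
        ⊢a-witness (Any.tail (forcesE⇒¬forcesA pw) (q i))))
    refutation-propagates {w} (all-a (there p) q) with any? (λ j → forcesA? j w)
    ... | yes (j , wj) = inj₁ (⊢comp-forcesA wj (⊢¬a-from-other-a (⊢e-witness p) λ i i≢j →
          ⊢a-witness (Any.tail (λ wi → i≢j (forcesA-unique wi wj)) (q i))))
    ... | no ¬wA = inj₂ (clash (⊢e-witness p) (⊢¬e-from-all-a λ i →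
          ⊢a-witness (Any.tail (λ wi → ¬wA (i , wi)) (q i))))
    refutation-propagates (a-clash i (here qw) (here refl)) = ⊥-elim (forcesA⇒¬forcesNotZ qw by-¬a)
    refutation-propagates (a-clash i (here qw) (there r))   = inj₁ (⊢comp-forcesA qw (⊢α r))
    refutation-propagates (a-clash i (there q) (here refl)) = inj₁ (⊢a-witness q)
    refutation-propagates (a-clash i (there q) (there r))   = inj₂ (clash (⊢a-witness q) (⊢α r))

    entailed-propagates : ∀ {l} → IsPartialAssignment α → Entails enc α l → ⊢₁ l ⊎ ⊢ []
    entailed-propagates {l} pa α⊨l with l ∈? α
    ... | yes l∈α = inj₁ (⊢α l∈α)
    ... | no l∉α with refutation-or-model (isPartialAssignment-∷comp pa l∉α)
    ...   | inj₂ (σ , σ⊨enc , σ⊨¬l ∷ σ⊨α) = ⊥-elim (evalLit-comp σ l (α⊨l σ σ⊨enc σ⊨α) σ⊨¬l)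
    ...   | inj₁ r = Sum.map₁ (subst ⊢₁_ (comp-involutive l)) (refutation-propagates r)

  enc-PC : IsPC _≟ᵛ_ enc
  enc-PC α l pa α⊨l = Sum.map₁ ⊢₁⇒derivesLit (entailed-propagates pa α⊨l)
    where open Propagation α

lemma2 : Σ ℕ λ c → ∀ (m : ℕ) → 3 ≤ m →
    Σ ℕ λ k → Σ (CNF (PsiVar (m ∸ 1) ⊎ Fin k)) λ φ →
      IsPCEncoding psiVarDec (fψ m) φ × size φ ≤ c * numVars m
lemma2 = 5 , λ { (suc n) _ → suc n , enc n , (encodes n , enc-PC n) , size-bound n }
  where
  open Encoding using (enc; encodes; enc-PC)
  size-bound : ∀ n → size (enc n) ≤ 5 * numVars (suc n)
  size-bound n = begin
    size (enc n)            ≤⟨ m≤m+n _ 2 ⟩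
    size (enc n) + 2        ≡⟨ Encoding.size-enc n ⟩
    5 * suc n               ≤⟨ *-monoʳ-≤ 5 (m≤m+n (suc n) (2 * n)) ⟩
    5 * numVars (suc n)     ∎
    where open ≤-Reasoning
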